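{- Let $G$ be a finite simple graph on $[d]$ without isolated vertices. The following are equivalent: (i) $G$ is bipartite; (ii) $\mathrm{FRAC}(G)$ is a lattice polytope; (iii) $\mathcal{Q}(G)$ is a lattice polytope.
   Context: For a finite simple graph $G$ on $[d]$ with edge set $E(G)$, $\mathrm{FRAC}(G)=\{(x_1,\ldots,x_d)\in\mathbb{R}^d : x_i\ge 0\ (1\le i\le d),\ x_i+x_j\le 1\ ((i,j)\in E(G))\}$, and $\mathcal{Q}(G)=3\,\mathrm{FRAC}(G)-(1,\ldots,1)=\{(x_1,\ldots,x_d)\in\mathbb{R}^d : x_i\ge -1\ (1\le i\le d),\ x_i+x_j\le 1\ ((i,j)\in E(G))\}$. A lattice polytope is one all of whose vertices lie in $\mathbb{Z}^d$.
   Formalization: The polytopes $\mathrm{FRAC}(G)$ and $\mathcal{Q}(G)$, their vertices, and the points and coefficients of the convex combinations that define a vertex are taken in ℚ^d instead of ℝ^d. -}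

module Defs where

open import Data.Nat using (ℕ)
open import Data.Integer using (ℤ; +_; -[1+_])
open import Data.Rational using (ℚ; _/_; _+_; _*_; _-_; _≤_; _<_; 0ℚ; 1ℚ)
open import Data.Fin using (Fin)
open import Data.Bool using (Bool; true; false)
open import Data.Product using (Σ; ∃; _×_)
open import Data.Empty using (⊥)
open import Relation.Binary.PropositionalEquality using (_≡_; _≢_)

record SimpleGraph (d : ℕ) : Set where
  field
    Adj    : Fin d → Fin d → Bool
    symm   : ∀ i j → Adj i j ≡ Adj j i
    irrefl : ∀ i → Adj i i ≡ false

open SimpleGraph public

Edge : ∀ {d} → SimpleGraph d → Fin d → Fin d → Set
Edge G i j = Adj G i j ≡ true

NoIsolatedVertices : ∀ {d} → SimpleGraph d → Set
NoIsolatedVertices {d} G = ∀ (i : Fin d) → ∃ λ (j : Fin d) → Edge G i j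

Bipartite : ∀ {d} → SimpleGraph d → Set
Bipartite {d} G = ∃ λ (c : Fin d → Bool) → ∀ i j → Edge G i j → c i ≢ c j

-- Points of ℚ^d.  (All polytopes here are defined by rational
-- inequalities, hence all their vertices are rational.)
Point : ℕ → Set
Point d = Fin d → ℚ

Region : ℕ → Set₁
Region d = Point d → Set

-1ℚ : ℚ
-1ℚ = -[1+ 0 ] / 1

FRAC : ∀ {d} → SimpleGraph d → Region d
FRAC {d} G x = (∀ (i : Fin d) → 0ℚ ≤ x i)
             × (∀ (i j : Fin d) → Edge G i j → x i + x j ≤ 1ℚ)

-- Q(G) = 3 FRAC(G) - (1,…,1) = { x : x_i ≥ -1, x_i + x_j ≤ 1 for (i,j) ∈ E(G) }
QG : ∀ {d} → SimpleGraph d → Region d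
QG {d} G x = (∀ (i : Fin d) → -1ℚ ≤ x i)
           × (∀ (i j : Fin d) → Edge G i j → x i + x j ≤ 1ℚ)

IsVertex : ∀ {d} → Region d → Point d → Set
IsVertex {d} P x =
  P x × (∀ (y z : Point d) (λ' : ℚ) → P y → P z → 0ℚ < λ' → λ' < 1ℚ →
          (∀ i → x i ≡ λ' * y i + (1ℚ - λ') * z i) → ∀ i → y i ≡ z i)

IsIntegral : ∀ {d} → Point d → Set
IsIntegral x = ∀ i → ∃ λ (k : ℤ) → x i ≡ k / 1

IsLatticePolytope : ∀ {d} → Region d → Set
IsLatticePolytope {d} P = ∀ (x : Point d) → IsVertex P x → IsIntegral x

{-# OPTIONS --safe #-}
module Submission where

-- If G is bipartite, every vertex x of FRAC(G) is a 0/1 point: moving each x_i by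
-- ±x_i(1 − x_i)/2, with opposite signs on the two colour classes, gives two points of
-- FRAC(G) with midpoint x, so they coincide and x_i(1 − x_i) = 0.  (The bound x_i ≤ 1
-- used here needs a neighbour of i.)  Q(G) is the image of FRAC(G) under t ↦ 3t − 1,
-- which maps vertices to vertices and {0, 1} to {−1, 2}.
--
-- Conversely, let ℓ ≤ ½ and let H be an inclusion-minimal vertex set inducing a
-- non-bipartite subgraph.  The point p that is ½ on H and ℓ elsewhere lies in
-- {x ≥ ℓ, x_i + x_j ≤ 1}.  If p = l y + (1 − l) z there, the tight constraints force
-- y = z off H and w_i + w_j = 0 along the edges of G[H], where w = y − z.  No edge of
-- G[H] then joins the zero set of w to its complement, on which the sign of w is a
-- proper 2-colouring; so if w ≠ 0 somewhere, the zero set is a proper subset of H and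
-- minimality makes H bipartite.  Hence p is a vertex with a coordinate ½.  Taking
-- ℓ = 0 and ℓ = −1 covers FRAC(G) and Q(G).

open import Defs
open import Data.Nat using (ℕ)
open import Data.Product using (_×_)
open import Function.Bundles using (_⇔_)

open import Data.Bool using (Bool; true; false; if_then_else_; not)
import Data.Bool.Properties as Bool
open import Data.Empty using (⊥-elim)
open import Data.Fin using (Fin)
open import Data.Fin.Properties using (all?)
open import Data.Fin.Subset using (Subset; _∈_; _∉_; _⊂_; _∩_; ⊤; Empty)
open import Data.Fin.Subset.Induction using (⊂-wellFounded)
open import Data.Fin.Subset.Properties
  using (_∈?_; nonempty?; anySubset?; ∈⊤; p∩q⊆p; x∈p∩q⁺; x∈p∩q⁻)
open import Data.Integer using (+_; -[1+_]; ∣_∣)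
open import Data.Nat.Coprimality using (Coprime; gcd≡1⇒coprime)
open import Data.Nat.GCD using (gcd-zeroʳ)
open import Data.Nat.Properties using (1+n≢n)
open import Data.Product using (∃; _,_; proj₁; proj₂)
open import Data.Rational
  using (ℚ; _+_; _*_; _-_; -_; _≤_; _<_; 0ℚ; 1ℚ; ½; _/_; mkℚ; ↧ₙ_;
         Positive; NonNegative; positive; nonNegative)
open import Data.Rational.Properties
  using (_≟_; _<?_; _≤?_; ≤-refl; ≤-antisym; ≮⇒≥; <-irrefl;
         +-mono-≤; +-monoˡ-≤; +-monoʳ-≤; +-mono-<; +-monoˡ-<; +-mono-<-≤; +-mono-≤-<;
         +-comm; +-identityʳ; +-inverseʳ; +-0-group; neg-antimono-≤;
         *-monoˡ-≤-nonNeg; *-monoʳ-<-pos; pos⇒nonNeg; positive⁻¹; nonNegative⁻¹;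
         nonNeg*nonNeg⇒nonNeg; pos*pos⇒pos; ↥p/↧p≡p; module ≤-Reasoning)
open import Data.Rational.Solver using (module +-*-Solver)
open import Data.Sum using (_⊎_; inj₁; inj₂; [_,_]′)
open import Data.Vec using (lookup; tabulate)
open import Data.Vec.Properties using (lookup∘tabulate; []=⇒lookup; lookup⇒[]=)
open import Function using (_∘_)
open import Function.Bundles using (mk⇔)
open import Induction.WellFounded using (module All)
open import Level using (0ℓ)
open import Relation.Binary.PropositionalEquality
  using (_≡_; _≢_; refl; sym; trans; cong; cong₂; subst; subst₂; module ≡-Reasoning)
open import Relation.Nullary using (¬_; Dec; yes; no; does; ¬?)
open import Relation.Nullary.Decidable
  using (_→-dec_; dec-true; dec-false; decidable-stable; from-yes)
import Relation.Nullary.Decidable as Dec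

open import Algebra.Properties.Group +-0-group using (inverseˡ-unique; inverseʳ-unique; x∙y⁻¹≈ε⇒x≈y)
open +-*-Solver using (solve; _:+_; _:*_; _:-_; _:=_; con)

p<q⇒0<q-p : ∀ {p q} → p < q → 0ℚ < q - p
p<q⇒0<q-p {p} {q} p<q = subst (_< q - p) (+-inverseʳ p) (+-monoˡ-< (- p) p<q)

p≤q⇒0≤q-p : ∀ {p q} → p ≤ q → 0ℚ ≤ q - p
p≤q⇒0≤q-p {p} {q} p≤q = subst (_≤ q - p) (+-inverseʳ p) (+-monoˡ-≤ (- p) p≤q)

*-nonNeg : ∀ {p q} → 0ℚ ≤ p → 0ℚ ≤ q → 0ℚ ≤ p * q
*-nonNeg {p} {q} 0≤p 0≤q =
  nonNegative⁻¹ (p * q) {{nonNeg*nonNeg⇒nonNeg p {{nonNegative 0≤p}} q {{nonNegative 0≤q}}}}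

*-pos : ∀ {p q} → 0ℚ < p → 0ℚ < q → 0ℚ < p * q
*-pos {p} {q} 0<p 0<q = positive⁻¹ (p * q) {{pos*pos⇒pos p {{positive 0<p}} q {{positive 0<q}}}}

opposite-signs : ∀ {s t} → s + t ≡ 0ℚ → s ≢ 0ℚ →
  (0<s? : Dec (0ℚ < s)) (0<t? : Dec (0ℚ < t)) → does 0<s? ≢ does 0<t?
opposite-signs s+t≡0 _ (yes 0<s) (yes 0<t) = λ _ → <-irrefl (sym s+t≡0) (+-mono-< 0<s 0<t)
opposite-signs {s} {t} s+t≡0 s≢0 (no 0≮s) (no 0≮t) = λ _ → s≢0 (≤-antisym (≮⇒≥ 0≮s) (begin
  0ℚ      ≡⟨ sym s+t≡0 ⟩
  s + t   ≤⟨ +-monoʳ-≤ s (≮⇒≥ 0≮t) ⟩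
  s + 0ℚ  ≡⟨ +-identityʳ s ⟩
  s       ∎))
  where open ≤-Reasoning
opposite-signs _ _ (yes _) (no _) = λ ()
opposite-signs _ _ (no _) (yes _) = λ ()

-- k / 1 normalises to mkℚ k 0 _, whose denominator is 1, not 2.
½-not-integral : ∀ k → ½ ≢ k / 1
½-not-integral k ½≡k/1 = 1+n≢n (cong ↧ₙ_ (trans ½≡k/1 (↥p/↧p≡p (mkℚ k 0 k/1-coprime))))
  where
  k/1-coprime : Coprime ∣ k ∣ 1
  k/1-coprime = gcd≡1⇒coprime (gcd-zeroʳ ∣ k ∣)

mix-diag : ∀ l c → l * c + (1ℚ - l) * c ≡ c
mix-diag = solve 2 (λ l c → l :* c :+ (con 1ℚ :- l) :* c := c) refl

mix-+ : ∀ l a b c d → l * (a + b) + (1ℚ - l) * (c + d) ≡ (l * a + (1ℚ - l) * c) + (l * b + (1ℚ - l) * d)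
mix-+ = solve 5 (λ l a b c d → l :* (a :+ b) :+ (con 1ℚ :- l) :* (c :+ d)
                   := (l :* a :+ (con 1ℚ :- l) :* c) :+ (l :* b :+ (con 1ℚ :- l) :* d)) refl

module _ {l : ℚ} (0<l : 0ℚ < l) (l<1 : l < 1ℚ) where
  private
    instance
      l-pos : Positive l
      l-pos = positive 0<l
      1-l-pos : Positive (1ℚ - l)
      1-l-pos = positive (p<q⇒0<q-p l<1)
      l-nonNeg : NonNegative l
      l-nonNeg = pos⇒nonNeg l
      1-l-nonNeg : NonNegative (1ℚ - l)
      1-l-nonNeg = pos⇒nonNeg (1ℚ - l)

  mix-< : ∀ {s t c} → s ≤ c → t ≤ c → s < c ⊎ t < c → l * s + (1ℚ - l) * t < c
  mix-< {s} {t} {c} s≤c t≤c s<c⊎t<c = begin-strict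
    l * s + (1ℚ - l) * t  <⟨ mono s<c⊎t<c ⟩
    l * c + (1ℚ - l) * c  ≡⟨ mix-diag l c ⟩
    c                     ∎
    where
    open ≤-Reasoning
    mono : s < c ⊎ t < c → l * s + (1ℚ - l) * t < l * c + (1ℚ - l) * c
    mono (inj₁ s<c) = +-mono-<-≤ (*-monoʳ-<-pos l s<c) (*-monoˡ-≤-nonNeg (1ℚ - l) t≤c)
    mono (inj₂ t<c) = +-mono-≤-< (*-monoˡ-≤-nonNeg l s≤c) (*-monoʳ-<-pos (1ℚ - l) t<c)

  mix-> : ∀ {s t c} → c ≤ s → c ≤ t → c < s ⊎ c < t → c < l * s + (1ℚ - l) * t
  mix-> {s} {t} {c} c≤s c≤t c<s⊎c<t = begin-strict
    c                     ≡⟨ sym (mix-diag l c) ⟩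
    l * c + (1ℚ - l) * c  <⟨ mono c<s⊎c<t ⟩
    l * s + (1ℚ - l) * t  ∎
    where
    open ≤-Reasoning
    mono : c < s ⊎ c < t → l * c + (1ℚ - l) * c < l * s + (1ℚ - l) * t
    mono (inj₁ c<s) = +-mono-<-≤ (*-monoʳ-<-pos l c<s) (*-monoˡ-≤-nonNeg (1ℚ - l) c≤t)
    mono (inj₂ c<t) = +-mono-≤-< (*-monoˡ-≤-nonNeg l c≤s) (*-monoʳ-<-pos (1ℚ - l) c<t)

  mix-≤-tight : ∀ {s t c} → s ≤ c → t ≤ c → l * s + (1ℚ - l) * t ≡ c → s ≡ c × t ≡ c
  mix-≤-tight s≤c t≤c mix≡c =
    ≤-antisym s≤c (≮⇒≥ λ s<c → <-irrefl mix≡c (mix-< s≤c t≤c (inj₁ s<c))) ,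
    ≤-antisym t≤c (≮⇒≥ λ t<c → <-irrefl mix≡c (mix-< s≤c t≤c (inj₂ t<c)))

  mix-≥-tight : ∀ {s t c} → c ≤ s → c ≤ t → l * s + (1ℚ - l) * t ≡ c → s ≡ c × t ≡ c
  mix-≥-tight c≤s c≤t mix≡c =
    sym (≤-antisym c≤s (≮⇒≥ λ c<s → <-irrefl (sym mix≡c) (mix-> c≤s c≤t (inj₁ c<s)))) ,
    sym (≤-antisym c≤t (≮⇒≥ λ c<t → <-irrefl (sym mix≡c) (mix-> c≤s c≤t (inj₂ c<t))))

module _ {d : ℕ} where

  ProperColouringOn : SimpleGraph d → Subset d → (Fin d → Bool) → Set
  ProperColouringOn G H c = ∀ i j → i ∈ H → j ∈ H → Edge G i j → c i ≢ c j

  BipartiteOn : SimpleGraph d → Subset d → Set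
  BipartiteOn G H = ∃ (ProperColouringOn G H)

  zeroSet : Point d → Subset d
  zeroSet w = tabulate (λ i → does (w i ≟ 0ℚ))

  ∈-zeroSet⁺ : ∀ w {i} → w i ≡ 0ℚ → i ∈ zeroSet w
  ∈-zeroSet⁺ w {i} wi≡0 =
    lookup⇒[]= i (zeroSet w) (trans (lookup∘tabulate _ i) (dec-true (w i ≟ 0ℚ) wi≡0))

  ∈-zeroSet⁻ : ∀ w {i} → i ∈ zeroSet w → w i ≡ 0ℚ
  ∈-zeroSet⁻ w {i} i∈zeros with w i ≟ 0ℚ | trans (sym (lookup∘tabulate _ i)) ([]=⇒lookup i∈zeros)
  ... | yes wi≡0 | _ = wi≡0
  ... | no _     | ()

  properColouringOn? : ∀ G H c → Dec (ProperColouringOn G H c)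
  properColouringOn? G H c = all? λ i → all? λ j →
    (i ∈? H) →-dec (j ∈? H) →-dec (Adj G i j Bool.≟ true) →-dec ¬? (c i Bool.≟ c j)

  bipartiteOn? : ∀ G H → Dec (BipartiteOn G H)
  bipartiteOn? G H = Dec.map
    (mk⇔ (λ (c , proper) → lookup c , proper) (λ (c , proper) → tabulate c , tabulate-proper c proper))
    (anySubset? (properColouringOn? G H ∘ lookup))
    where
    tabulate-proper : ∀ c → ProperColouringOn G H c → ProperColouringOn G H (lookup (tabulate c))
    tabulate-proper c proper i j i∈H j∈H e =
      proper i j i∈H j∈H e ∘ subst₂ _≡_ (lookup∘tabulate c i) (lookup∘tabulate c j)

  empty⇒bipartiteOn : ∀ G {H} → Empty H → BipartiteOn G H
  empty⇒bipartiteOn G empty = (λ _ → true) , λ i _ i∈H _ _ _ → empty (i , i∈H)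

  bipartiteOn-⊤⇒bipartite : ∀ G → BipartiteOn G ⊤ → Bipartite G
  bipartiteOn-⊤⇒bipartite G (c , proper) = c , λ i j → proper i j ∈⊤ ∈⊤

  bipartiteOn-zeroSet : ∀ G {H} (w : Point d) →
    (∀ i j → i ∈ H → j ∈ H → Edge G i j → w i + w j ≡ 0ℚ) →
    BipartiteOn G (H ∩ zeroSet w) → BipartiteOn G H
  bipartiteOn-zeroSet G {H} w antisym (c₀ , proper₀) = c , proper
    where
    c : Fin d → Bool
    c i = if does (w i ≟ 0ℚ) then c₀ i else does (0ℚ <? w i)
    proper : ProperColouringOn G H c
    proper i j i∈H j∈H e with w i ≟ 0ℚ | w j ≟ 0ℚ
    ... | yes wi≡0 | yes wj≡0 =
      proper₀ i j (x∈p∩q⁺ (i∈H , ∈-zeroSet⁺ w wi≡0)) (x∈p∩q⁺ (j∈H , ∈-zeroSet⁺ w wj≡0)) e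
    ... | yes wi≡0 | no wj≢0  =
      ⊥-elim (wj≢0 (trans (inverseʳ-unique (w i) (w j) (antisym i j i∈H j∈H e)) (cong -_ wi≡0)))
    ... | no wi≢0  | yes wj≡0 =
      ⊥-elim (wi≢0 (trans (inverseˡ-unique (w i) (w j) (antisym i j i∈H j∈H e)) (cong -_ wj≡0)))
    ... | no wi≢0  | no _     = opposite-signs (antisym i j i∈H j∈H e) wi≢0 (0ℚ <? w i) (0ℚ <? w j)

-- FRAC G and QG G unfold to FRAC≥ 0ℚ G and FRAC≥ -1ℚ G.
FRAC≥ : ∀ {d} → ℚ → SimpleGraph d → Region d
FRAC≥ {d} ℓ G x = (∀ (i : Fin d) → ℓ ≤ x i)
                 × (∀ (i j : Fin d) → Edge G i j → x i + x j ≤ 1ℚ)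

module _ {d} (G : SimpleGraph d) {ℓ : ℚ} (ℓ≤½ : ℓ ≤ ½) where

  halfOn : Subset d → Point d
  halfOn H i = if does (i ∈? H) then ½ else ℓ

  halfOn-∈ : ∀ {H i} → i ∈ H → halfOn H i ≡ ½
  halfOn-∈ {H} {i} i∈H rewrite dec-true (i ∈? H) i∈H = refl

  halfOn-∉ : ∀ {H i} → i ∉ H → halfOn H i ≡ ℓ
  halfOn-∉ {H} {i} i∉H rewrite dec-false (i ∈? H) i∉H = refl

  halfOn∈FRAC≥ : ∀ H → FRAC≥ ℓ G (halfOn H)
  halfOn∈FRAC≥ H = ℓ≤halfOn , λ i j _ → +-mono-≤ (halfOn≤½ i) (halfOn≤½ j)
    where
    ℓ≤halfOn : ∀ i → ℓ ≤ halfOn H i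
    ℓ≤halfOn i with does (i ∈? H)
    ... | true  = ℓ≤½
    ... | false = ≤-refl
    halfOn≤½ : ∀ i → halfOn H i ≤ ½
    halfOn≤½ i with does (i ∈? H)
    ... | true  = ≤-refl
    ... | false = ℓ≤½

  module Decomposition {H : Subset d} {y z : Point d} {l : ℚ}
    (y∈ : FRAC≥ ℓ G y) (z∈ : FRAC≥ ℓ G z) (0<l : 0ℚ < l) (l<1 : l < 1ℚ)
    (halfOn≡mix : ∀ i → halfOn H i ≡ l * y i + (1ℚ - l) * z i) where

    agree-outside : ∀ {i} → i ∉ H → y i ≡ z i
    agree-outside {i} i∉H = trans (proj₁ tight) (sym (proj₂ tight))
      where
      tight = mix-≥-tight 0<l l<1 (proj₁ y∈ i) (proj₁ z∈ i)
                (trans (sym (halfOn≡mix i)) (halfOn-∉ i∉H))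

    difference-antisymmetric : ∀ i j → i ∈ H → j ∈ H → Edge G i j → (y i - z i) + (y j - z j) ≡ 0ℚ
    difference-antisymmetric i j i∈H j∈H e = begin
      (y i - z i) + (y j - z j)  ≡⟨ solve 4 (λ a b c d → (a :- c) :+ (b :- d) := (a :+ b) :- (c :+ d))
                                           refl (y i) (y j) (z i) (z j) ⟩
      (y i + y j) - (z i + z j)  ≡⟨ cong₂ _-_ (proj₁ tight) (proj₂ tight) ⟩
      1ℚ - 1ℚ                    ≡⟨⟩
      0ℚ                         ∎
      where
      open ≡-Reasoning
      mix≡1 : l * (y i + y j) + (1ℚ - l) * (z i + z j) ≡ 1ℚ
      mix≡1 = begin
        l * (y i + y j) + (1ℚ - l) * (z i + z j)
          ≡⟨ mix-+ l (y i) (y j) (z i) (z j) ⟩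
        (l * y i + (1ℚ - l) * z i) + (l * y j + (1ℚ - l) * z j)
          ≡⟨ cong₂ _+_ (halfOn≡mix i) (halfOn≡mix j) ⟨
        halfOn H i + halfOn H j
          ≡⟨ cong₂ _+_ (halfOn-∈ i∈H) (halfOn-∈ j∈H) ⟩
        ½ + ½
          ≡⟨⟩
        1ℚ ∎
      tight = mix-≤-tight 0<l l<1 (proj₂ y∈ i j e) (proj₂ z∈ i j e) mix≡1

  halfOn-isVertex : ∀ {H} → ¬ BipartiteOn G H → (∀ {Z} → Z ⊂ H → BipartiteOn G Z) →
    IsVertex (FRAC≥ ℓ G) (halfOn H)
  halfOn-isVertex {H} ¬bipartite minimal = halfOn∈FRAC≥ H , agree
    where
    agree : ∀ y z l → FRAC≥ ℓ G y → FRAC≥ ℓ G z → 0ℚ < l → l < 1ℚ →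
      (∀ i → halfOn H i ≡ l * y i + (1ℚ - l) * z i) → ∀ k → y k ≡ z k
    agree y z l y∈ z∈ 0<l l<1 halfOn≡mix k = decidable-stable (y k ≟ z k) λ yk≢zk →
      ¬bipartite (bipartiteOn-zeroSet G w difference-antisymmetric (minimal (zeros⊂H yk≢zk)))
      where
      open Decomposition y∈ z∈ 0<l l<1 halfOn≡mix
      w : Point d
      w i = y i - z i
      zeros⊂H : y k ≢ z k → H ∩ zeroSet w ⊂ H
      zeros⊂H yk≢zk = p∩q⊆p H (zeroSet w) , k , k∈H , k∉zeros
        where
        k∈H = decidable-stable (k ∈? H) (yk≢zk ∘ agree-outside)
        k∉zeros = λ k∈zeros →
          yk≢zk (x∙y⁻¹≈ε⇒x≈y (y k) (z k) (∈-zeroSet⁻ w (proj₂ (x∈p∩q⁻ H _ k∈zeros))))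

FRAC≥-lattice⇒bipartite : ∀ {d} (G : SimpleGraph d) {ℓ} → ℓ ≤ ½ →
  IsLatticePolytope (FRAC≥ ℓ G) → Bipartite G
FRAC≥-lattice⇒bipartite G ℓ≤½ lattice =
  bipartiteOn-⊤⇒bipartite G (All.wfRec ⊂-wellFounded 0ℓ (BipartiteOn G) step ⊤)
  where
  step : ∀ H → (∀ {Z} → Z ⊂ H → BipartiteOn G Z) → BipartiteOn G H
  step H minimal = decidable-stable (bipartiteOn? G H) λ ¬bipartite →
    let (k , k∈H) = decidable-stable (nonempty? H) (¬bipartite ∘ empty⇒bipartiteOn G)
        (m , halfOn≡m) = lattice (halfOn G ℓ≤½ H) (halfOn-isVertex G ℓ≤½ ¬bipartite minimal) k
    in ½-not-integral m (trans (sym (halfOn-∈ G ℓ≤½ k∈H)) halfOn≡m)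

δ : ℚ → ℚ
δ t = t * (1ℚ - t) * ½

raise lower : ℚ → ℚ
raise t = t + δ t
lower t = t - δ t

raise-nonNeg : ∀ {t} → 0ℚ ≤ t → t ≤ 1ℚ → 0ℚ ≤ raise t
raise-nonNeg 0≤t t≤1 = +-mono-≤ 0≤t (*-nonNeg (*-nonNeg 0≤t (p≤q⇒0≤q-p t≤1)) (nonNegative⁻¹ ½))

lower-nonNeg : ∀ {t} → 0ℚ ≤ t → 0ℚ ≤ lower t
lower-nonNeg {t} 0≤t = begin
  0ℚ
    ≤⟨ *-nonNeg (*-nonNeg 0≤t (+-mono-≤ (nonNegative⁻¹ 1ℚ) 0≤t)) (nonNegative⁻¹ ½) ⟩
  t * (1ℚ + t) * ½
    ≡⟨ solve 1 (λ t → t :* (con 1ℚ :+ t) :* con ½ := t :- t :* (con 1ℚ :- t) :* con ½) refl t ⟩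
  lower t ∎
  where open ≤-Reasoning

raise+lower≤1 : ∀ {a b} → a ≤ 1ℚ → 0ℚ ≤ b → a + b ≤ 1ℚ → raise a + lower b ≤ 1ℚ
raise+lower≤1 {a} {b} a≤1 0≤b a+b≤1 = begin
  raise a + lower b
    ≡⟨ solve 2 (λ a b → (a :+ a :* (con 1ℚ :- a) :* con ½) :+ (b :- b :* (con 1ℚ :- b) :* con ½)
                 := con 1ℚ :- (con 1ℚ :- (a :+ b)) :* ((con 1ℚ :- a) :+ (con 1ℚ :+ b)) :* con ½)
               refl a b ⟩
  1ℚ - slack
    ≤⟨ +-monoʳ-≤ 1ℚ (neg-antimono-≤ 0≤slack) ⟩
  1ℚ ∎
  where
  open ≤-Reasoning
  slack = (1ℚ - (a + b)) * ((1ℚ - a) + (1ℚ + b)) * ½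
  0≤slack : 0ℚ ≤ slack
  0≤slack = *-nonNeg (*-nonNeg (p≤q⇒0≤q-p a+b≤1)
              (+-mono-≤ (p≤q⇒0≤q-p a≤1) (+-mono-≤ (nonNegative⁻¹ 1ℚ) 0≤b))) (nonNegative⁻¹ ½)

raise≡lower⇒δ≡0 : ∀ t → raise t ≡ lower t → δ t ≡ 0ℚ
raise≡lower⇒δ≡0 t raise≡lower = begin
  δ t                      ≡⟨ solve 2 (λ t e → e := ((t :+ e) :- (t :- e)) :* con ½) refl t (δ t) ⟩
  (raise t - lower t) * ½  ≡⟨ cong (λ r → (r - lower t) * ½) raise≡lower ⟩
  (lower t - lower t) * ½  ≡⟨ cong (_* ½) (+-inverseʳ (lower t)) ⟩
  0ℚ                       ∎
  where open ≡-Reasoning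

δ≡0⇒0∨1 : ∀ {t} → 0ℚ ≤ t → t ≤ 1ℚ → δ t ≡ 0ℚ → t ≡ 0ℚ ⊎ t ≡ 1ℚ
δ≡0⇒0∨1 {t} 0≤t t≤1 δ≡0 with 0ℚ <? t | t <? 1ℚ
... | no 0≮t  | _       = inj₁ (≤-antisym (≮⇒≥ 0≮t) 0≤t)
... | yes _   | no t≮1  = inj₂ (≤-antisym t≤1 (≮⇒≥ t≮1))
... | yes 0<t | yes t<1 = ⊥-elim (<-irrefl (sym δ≡0) (*-pos (*-pos 0<t (p<q⇒0<q-p t<1)) (positive⁻¹ ½)))

perturb : ∀ {d} → (Fin d → Bool) → Point d → Point d
perturb c x i = if c i then raise (x i) else lower (x i)

perturb∈FRAC : ∀ {d} (G : SimpleGraph d) {c x} → (∀ i j → Edge G i j → c i ≢ c j) →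
  FRAC G x → (∀ i → x i ≤ 1ℚ) → FRAC G (perturb c x)
perturb∈FRAC G {c} {x} proper (x≥0 , x-edge) x≤1 = nonNeg , edge
  where
  nonNeg : ∀ i → 0ℚ ≤ perturb c x i
  nonNeg i with c i
  ... | true  = raise-nonNeg (x≥0 i) (x≤1 i)
  ... | false = lower-nonNeg (x≥0 i)
  edge : ∀ i j → Edge G i j → perturb c x i + perturb c x j ≤ 1ℚ
  edge i j e with c i | c j | proper i j e
  ... | true  | true  | ci≢cj = ⊥-elim (ci≢cj refl)
  ... | true  | false | _     = raise+lower≤1 (x≤1 i) (x≥0 j) (x-edge i j e)
  ... | false | true  | _     = subst (_≤ 1ℚ) (+-comm (raise (x j)) (lower (x i)))
    (raise+lower≤1 (x≤1 j) (x≥0 i) (subst (_≤ 1ℚ) (+-comm (x i) (x j)) (x-edge i j e)))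
  ... | false | false | ci≢cj = ⊥-elim (ci≢cj refl)

perturb-midpoint : ∀ {d} c (x : Point d) i → x i ≡ ½ * perturb c x i + (1ℚ - ½) * perturb (not ∘ c) x i
perturb-midpoint c x i with c i
... | true  = solve 2 (λ t e → t := con ½ :* (t :+ e) :+ (con 1ℚ :- con ½) :* (t :- e)) refl (x i) (δ (x i))
... | false = solve 2 (λ t e → t := con ½ :* (t :- e) :+ (con 1ℚ :- con ½) :* (t :+ e)) refl (x i) (δ (x i))

bipartite⇒FRAC-vertex∈01 : ∀ {d} (G : SimpleGraph d) → NoIsolatedVertices G → Bipartite G →
  ∀ {x} → IsVertex (FRAC G) x → ∀ i → x i ≡ 0ℚ ⊎ x i ≡ 1ℚ
bipartite⇒FRAC-vertex∈01 G noIsolated (c , proper) {x} (x∈@(x≥0 , x-edge) , extreme) i =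
  δ≡0⇒0∨1 (x≥0 i) (x≤1 i) (raise≡lower⇒δ≡0 (x i) (raise≡lower i))
  where
  x≤1 : ∀ i → x i ≤ 1ℚ
  x≤1 i = let (j , e) = noIsolated i in begin
    x i        ≡⟨ sym (+-identityʳ (x i)) ⟩
    x i + 0ℚ   ≤⟨ +-monoʳ-≤ (x i) (x≥0 j) ⟩
    x i + x j  ≤⟨ x-edge i j e ⟩
    1ℚ         ∎
    where open ≤-Reasoning
  proper′ : ∀ i j → Edge G i j → not (c i) ≢ not (c j)
  proper′ i j e = proper i j e ∘ Bool.not-injective
  perturbations-agree : ∀ i → perturb c x i ≡ perturb (not ∘ c) x i
  perturbations-agree = extreme (perturb c x) (perturb (not ∘ c) x) ½
    (perturb∈FRAC G proper x∈ x≤1) (perturb∈FRAC G proper′ x∈ x≤1)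
    (positive⁻¹ ½) (from-yes (½ <? 1ℚ)) (perturb-midpoint c x)
  raise≡lower : ∀ i → raise (x i) ≡ lower (x i)
  raise≡lower i with c i | perturbations-agree i
  ... | true  | agree = agree
  ... | false | agree = sym agree

bipartite⇒FRAC-lattice : ∀ {d} (G : SimpleGraph d) → NoIsolatedVertices G → Bipartite G →
  IsLatticePolytope (FRAC G)
bipartite⇒FRAC-lattice G noIsolated bipartite x x-vertex i =
  [ (+ 0 ,_) , (+ 1 ,_) ]′ (bipartite⇒FRAC-vertex∈01 G noIsolated bipartite x-vertex i)

IsVertex-pullback : ∀ {d} {P Q : Region d} (φ ψ : ℚ → ℚ) →
  (∀ t → ψ (φ t) ≡ t) → (∀ t → φ (ψ t) ≡ t) →
  (∀ l s t → φ (l * s + (1ℚ - l) * t) ≡ l * φ s + (1ℚ - l) * φ t) →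
  (∀ {u} → P u → Q (φ ∘ u)) → (∀ {x} → Q x → P (ψ ∘ x)) →
  ∀ {x} → IsVertex Q x → IsVertex P (ψ ∘ x)
IsVertex-pullback {P = P} φ ψ ψ∘φ φ∘ψ φ-affine P⇒Q Q⇒P {x} (x∈Q , extreme) = Q⇒P x∈Q , agree
  where
  open ≡-Reasoning
  agree : ∀ y z l → P y → P z → 0ℚ < l → l < 1ℚ →
    (∀ i → ψ (x i) ≡ l * y i + (1ℚ - l) * z i) → ∀ i → y i ≡ z i
  agree y z l y∈P z∈P 0<l l<1 ψx≡mix i = begin
    y i          ≡⟨ sym (ψ∘φ (y i)) ⟩
    ψ (φ (y i))  ≡⟨ cong ψ (extreme (φ ∘ y) (φ ∘ z) l (P⇒Q y∈P) (P⇒Q z∈P) 0<l l<1 x≡mix i) ⟩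
    ψ (φ (z i))  ≡⟨ ψ∘φ (z i) ⟩
    z i          ∎
    where
    x≡mix : ∀ i → x i ≡ l * φ (y i) + (1ℚ - l) * φ (z i)
    x≡mix i = begin
      x i                                ≡⟨ sym (φ∘ψ (x i)) ⟩
      φ (ψ (x i))                        ≡⟨ cong φ (ψx≡mix i) ⟩
      φ (l * y i + (1ℚ - l) * z i)       ≡⟨ φ-affine l (y i) (z i) ⟩
      l * φ (y i) + (1ℚ - l) * φ (z i)   ∎

3ℚ ⅓ : ℚ
3ℚ = + 3 / 1
⅓ = + 1 / 3

scale unscale : ℚ → ℚ
scale t = 3ℚ * t - 1ℚ
unscale t = ⅓ * (t + 1ℚ)

unscale∘scale : ∀ t → unscale (scale t) ≡ t
unscale∘scale = solve 1 (λ t → con ⅓ :* ((con 3ℚ :* t :- con 1ℚ) :+ con 1ℚ) := t) refl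

scale∘unscale : ∀ t → scale (unscale t) ≡ t
scale∘unscale = solve 1 (λ t → con 3ℚ :* (con ⅓ :* (t :+ con 1ℚ)) :- con 1ℚ := t) refl

scale-affine : ∀ l s t → scale (l * s + (1ℚ - l) * t) ≡ l * scale s + (1ℚ - l) * scale t
scale-affine = solve 3 (λ l s t → con 3ℚ :* (l :* s :+ (con 1ℚ :- l) :* t) :- con 1ℚ
                          := l :* (con 3ℚ :* s :- con 1ℚ) :+ (con 1ℚ :- l) :* (con 3ℚ :* t :- con 1ℚ)) refl

scale-mono-≤ : ∀ {s t} → s ≤ t → scale s ≤ scale t
scale-mono-≤ s≤t = +-monoˡ-≤ (- 1ℚ) (*-monoˡ-≤-nonNeg 3ℚ s≤t)

unscale-mono-≤ : ∀ {s t} → s ≤ t → unscale s ≤ unscale t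
unscale-mono-≤ s≤t = *-monoˡ-≤-nonNeg ⅓ (+-monoˡ-≤ 1ℚ s≤t)

scale-FRAC⇒QG : ∀ {d} (G : SimpleGraph d) {u} → FRAC G u → QG G (scale ∘ u)
scale-FRAC⇒QG G {u} (u≥0 , u-edge) = scale-mono-≤ ∘ u≥0 , edge
  where
  edge : ∀ i j → Edge G i j → scale (u i) + scale (u j) ≤ 1ℚ
  edge i j e = begin
    scale (u i) + scale (u j)   ≡⟨ solve 2 (λ a b → (con 3ℚ :* a :- con 1ℚ) :+ (con 3ℚ :* b :- con 1ℚ)
                                      := (con 3ℚ :* (a :+ b) :- con 1ℚ) :- con 1ℚ) refl (u i) (u j) ⟩
    scale (u i + u j) - 1ℚ      ≤⟨ +-monoˡ-≤ (- 1ℚ) (scale-mono-≤ (u-edge i j e)) ⟩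
    scale 1ℚ - 1ℚ               ≡⟨⟩
    1ℚ                          ∎
    where open ≤-Reasoning

unscale-QG⇒FRAC : ∀ {d} (G : SimpleGraph d) {x} → QG G x → FRAC G (unscale ∘ x)
unscale-QG⇒FRAC G {x} (x≥-1 , x-edge) = unscale-mono-≤ ∘ x≥-1 , edge
  where
  edge : ∀ i j → Edge G i j → unscale (x i) + unscale (x j) ≤ 1ℚ
  edge i j e = begin
    unscale (x i) + unscale (x j)   ≡⟨ solve 2 (λ a b → con ⅓ :* (a :+ con 1ℚ) :+ con ⅓ :* (b :+ con 1ℚ)
                                          := con ⅓ :* ((a :+ b :+ con 1ℚ) :+ con 1ℚ)) refl (x i) (x j) ⟩
    unscale (x i + x j + 1ℚ)        ≤⟨ unscale-mono-≤ (+-monoˡ-≤ 1ℚ (x-edge i j e)) ⟩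
    unscale (1ℚ + 1ℚ)               ≡⟨⟩
    1ℚ                              ∎
    where open ≤-Reasoning

bipartite⇒QG-lattice : ∀ {d} (G : SimpleGraph d) → NoIsolatedVertices G → Bipartite G →
  IsLatticePolytope (QG G)
bipartite⇒QG-lattice G noIsolated bipartite x x-vertex i =
  [ (λ u≡0 → -[1+ 0 ] , x≡scale u≡0) , (λ u≡1 → + 2 , x≡scale u≡1) ]′
    (bipartite⇒FRAC-vertex∈01 G noIsolated bipartite u-vertex i)
  where
  u-vertex : IsVertex (FRAC G) (unscale ∘ x)
  u-vertex = IsVertex-pullback scale unscale unscale∘scale scale∘unscale scale-affine
    (scale-FRAC⇒QG G) (unscale-QG⇒FRAC G) x-vertex
  x≡scale : ∀ {c} → unscale (x i) ≡ c → x i ≡ scale c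
  x≡scale u≡c = trans (sym (scale∘unscale (x i))) (cong scale u≡c)

proposition2p3 : (d : ℕ) (G : SimpleGraph d) → NoIsolatedVertices G →
    (Bipartite G ⇔ IsLatticePolytope (FRAC G))
    × (IsLatticePolytope (FRAC G) ⇔ IsLatticePolytope (QG G))
proposition2p3 d G noIsolated =
  mk⇔ (bipartite⇒FRAC-lattice G noIsolated) FRAC-lattice⇒bipartite ,
  mk⇔ (bipartite⇒QG-lattice G noIsolated ∘ FRAC-lattice⇒bipartite)
      (bipartite⇒FRAC-lattice G noIsolated ∘ QG-lattice⇒bipartite)
  where
  FRAC-lattice⇒bipartite : IsLatticePolytope (FRAC G) → Bipartite G
  FRAC-lattice⇒bipartite = FRAC≥-lattice⇒bipartite G (from-yes (0ℚ ≤? ½))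
  QG-lattice⇒bipartite : IsLatticePolytope (QG G) → Bipartite G
  QG-lattice⇒bipartite = FRAC≥-lattice⇒bipartite G (from-yes (-1ℚ ≤? ½))
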